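{- Let $n,k,r$ be positive integers with $r\geq 2$ and $n\geq rk$. The circular clique number of $\mathrm{IG}_{n,k}^{(r)}$ is $n/k$.
   Context: Write $[n]=\{1,\ldots,n\}$ and view its elements as placed in clockwise order on a circle; a $k$-subset of $[n]$ is called a $k$-polygon. A $k$-polygon $P$ is $r$-stable if the cyclic distance (on $\mathbb{Z}/n\mathbb{Z}$) between any two distinct points of $P$ is at least $r$. Two $k$-polygons $P=\{p_1<\cdots<p_k\}$ and $Q=\{q_1<\cdots<q_k\}$ interlace if either $p_1<q_1<p_2<q_2<\cdots<p_k<q_k$ or $q_1<p_1<q_2<p_2<\cdots<q_k<p_k$. The graph $\mathrm{IG}_{n,k}^{(r)}$ has as vertices the $r$-stable $k$-polygons on $[n]$, two being adjacent iff they interlace. For positive integers $a\geq 2b$, the circular clique $K_{a/b}$ is the graph with vertex set $\mathbb{Z}/a\mathbb{Z}$ in which two vertices are adjacent iff their cyclic distance is at least $b$. The circular clique number $\omega_c(G)$ of a graph $G$ is the maximum rational $a/b$ such that there is a graph homomorphism $K_{a/b}\to G$. -}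

module Defs where


open import Data.Nat using (ℕ; zero; suc; _+_; _*_; _∸_; _≤_; _<_; ∣_-_∣; _⊓_)
open import Data.Fin using (Fin; toℕ)
open import Data.Product using (Σ; _×_; _,_)
open import Data.Sum using (_⊎_)
open import Relation.Binary.PropositionalEquality using (_≡_; _≢_)

record Graph : Set₁ where
  field
    V   : Set
    Adj : V → V → Set
open Graph public

Hom : Graph → Graph → Set
Hom G H = Σ (V G → V H) λ f → ∀ x y → Adj G x y → Adj H (f x) (f y)

-- Cyclic distance on ℤ/mℤ between representatives x y (with |x - y| < m).
cdist : ℕ → ℕ → ℕ → ℕ
cdist m x y = ∣ x - y ∣ ⊓ (m ∸ ∣ x - y ∣)

K : ℕ → ℕ → Graph
K a b = record
  { V   = Fin a
  ; Adj = λ x y → b ≤ cdist a (toℕ x) (toℕ y) }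

-- A k-polygon on [n] = {1,…,n}, encoded by its elements listed in
-- increasing order p₁ < p₂ < ⋯ < p_k (indices Fin k, i.e. p 0 < p 1 < …).
record Polygon (n k : ℕ) : Set where
  field
    pt      : Fin k → ℕ
    inRange : ∀ i → 1 ≤ pt i × pt i ≤ n
    sorted  : ∀ i j → toℕ i < toℕ j → pt i < pt j
open Polygon public

Stable : ∀ {n k} → ℕ → Polygon n k → Set
Stable {n} r P = ∀ i j → i ≢ j → r ≤ cdist n (pt P i) (pt P j)

InterlaceLR : ∀ {n k} → Polygon n k → Polygon n k → Set
InterlaceLR {k = k} P Q =
  (∀ (i : Fin k) → pt P i < pt Q i) ×
  (∀ (i j : Fin k) → toℕ j ≡ suc (toℕ i) → pt Q i < pt P j)

Interlace : ∀ {n k} → Polygon n k → Polygon n k → Set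
Interlace P Q = InterlaceLR P Q ⊎ InterlaceLR Q P

IG : ℕ → ℕ → ℕ → Graph
IG n k r = record
  { V   = Σ (Polygon n k) (Stable r)
  ; Adj = λ P Q → Interlace (Σ.proj₁ P) (Σ.proj₁ Q) }

-- ω_c(G) = a/b (with a ≥ 2b, b ≥ 1): K_{a/b} → G exists, and for every
-- a'/b' with a' ≥ 2b', b' ≥ 1 and K_{a'/b'} → G we have a'/b' ≤ a/b.
CircCliqueNumberIs : Graph → ℕ → ℕ → Set
CircCliqueNumberIs G a b =
  Hom (K a b) G ×
  (∀ a' b' → 1 ≤ b' → 2 * b' ≤ a' → Hom (K a' b') G → a' * b ≤ a * b')

module Submission where

-- Lower bound: for x < n, the k-polygon with vertices 1 + ⌊(x + i n)/k⌋ (i < k) is r-stable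
-- since r k ≤ n, and the polygons of x and y interlace as soon as x and y are at cyclic
-- distance ≥ k, which gives a homomorphism K_{n/k} → IG.
-- Upper bound: P ↦ (Σ P) mod n is a homomorphism IG → K_{n/k}, because for interlacing
-- P, Q the difference Σ Q − Σ P lies between k and n − k. Finally K_{a/b} → K_{n/k} forces
-- a k ≤ n b: every residue mod n lies in exactly k of the n cyclic windows {s, …, s+k−1},
-- the preimage of a window is an independent set of K_{a/b}, and such a set has at most b
-- elements; double counting finishes the proof.

open import Defs
open import Function using (_∘_)
open import Data.Fin.Base using (Fin; toℕ; inject₁; fromℕ) renaming (zero to fzero; suc to fsuc)
open import Data.Fin.Properties using (toℕ-fromℕ<; toℕ<n; toℕ-inject₁; toℕ-injective)
open import Data.Nat.Base
open import Data.Nat.DivMod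
open import Data.Nat.Divisibility using (n∣m*n)
open import Data.Nat.Properties
open import Data.Nat.Tactic.RingSolver using (solve-∀)
open import Data.Product using (_×_; _,_; proj₁; proj₂; ∃-syntax)
open import Data.Sum using (inj₁; inj₂)
open import Relation.Binary using (tri<; tri≈; tri>)
open import Relation.Binary.PropositionalEquality
open import Relation.Nullary using (Dec; yes; no; contradiction)

open import Algebra.Properties.CommutativeSemigroup +-commutativeSemigroup using (xy∙z≈xz∙y; interchange)
open import Algebra.Properties.Monoid.Sum +-0-monoid using (sum; sum-init-last)

cdist-comm : ∀ m u w → cdist m u w ≡ cdist m w u
cdist-comm m u w = cong (λ e → e ⊓ (m ∸ e)) (∣-∣-comm u w)

cdist-+ : ∀ m u d → cdist m u (u + d) ≡ d ⊓ (m ∸ d)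
cdist-+ m u d = cong (λ e → e ⊓ (m ∸ e)) (∣m-m+n∣≡n u d)

cdist-self : ∀ m u → cdist m u u ≡ 0
cdist-self m u = trans (cong (cdist m u) (sym (+-identityʳ u))) (cdist-+ m u 0)

≤-⊓∸ : ∀ {m d r} → r ≤ d → d + r ≤ m → r ≤ d ⊓ (m ∸ d)
≤-⊓∸ {m} {d} {r} r≤d d+r≤m = ⊓-glb r≤d (m+n≤o⇒m≤o∸n r (subst (_≤ m) (+-comm d r) d+r≤m))

≤-⊓∸⁻ : ∀ {m d r} → d ≤ m → r ≤ d ⊓ (m ∸ d) → r ≤ d × d + r ≤ m
≤-⊓∸⁻ {m} {d} {r} d≤m r≤ =
  m≤n⊓o⇒m≤n d (m ∸ d) r≤ ,
  ≤-trans (≤-reflexive (+-comm d r)) (m≤o∸n⇒m+n≤o r d≤m (m≤n⊓o⇒m≤o d (m ∸ d) r≤))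

≤-cdist : ∀ {m u w r} → u + r ≤ w → w + r ≤ u + m → r ≤ cdist m u w
≤-cdist {m} {u} {w} {r} u+r≤w w+r≤u+m with w ∸ u | m+[n∸m]≡n (m+n≤o⇒m≤o u u+r≤w)
... | d | refl = subst (r ≤_) (sym (cdist-+ m u d))
  (≤-⊓∸ (+-cancelˡ-≤ u r d u+r≤w)
        (+-cancelˡ-≤ u (d + r) m (≤-trans (≤-reflexive (sym (+-assoc u d r))) w+r≤u+m)))

≤-cdist⁻ : ∀ {m u w r} → u ≤ w → w ≤ m → r ≤ cdist m u w → u + r ≤ w × w + r ≤ u + m
≤-cdist⁻ {m} {u} {w} {r} u≤w w≤m r≤ with w ∸ u | m+[n∸m]≡n u≤w
... | d | refl with ≤-⊓∸⁻ (≤-trans (m≤n+m d u) w≤m) (subst (r ≤_) (cdist-+ m u d) r≤)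
... | r≤d , d+r≤m =
  +-monoʳ-≤ u r≤d , ≤-trans (≤-reflexive (+-assoc u d r)) (+-monoʳ-≤ u d+r≤m)

module _ {n : ℕ} .{{_ : NonZero n}} where

  cdist-%-+ : ∀ x {d} → d ≤ n → cdist n (x % n) ((x + d) % n) ≡ d ⊓ (n ∸ d)
  cdist-%-+ x {d} d≤n = trans (cong (cdist n u) %-+-reduce) (reduced (u + d <? n))
    where
    u : ℕ
    u = x % n
    %-+-reduce : (x + d) % n ≡ (u + d) % n
    %-+-reduce = begin
      (x + d) % n                   ≡⟨ cong (λ y → (y + d) % n) (m≡m%n+[m/n]*n x n) ⟩
      (u + x / n * n + d) % n       ≡⟨ cong (_% n) (xy∙z≈xz∙y u _ d) ⟩
      (u + d + x / n * n) % n       ≡⟨ [m+kn]%n≡m%n (u + d) (x / n) n ⟩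
      (u + d) % n                   ∎
      where open ≡-Reasoning
    reduced : Dec (u + d < n) → cdist n u ((u + d) % n) ≡ d ⊓ (n ∸ d)
    reduced (yes u+d<n) = trans (cong (cdist n u) (m<n⇒m%n≡m u+d<n)) (cdist-+ n u d)
    reduced (no u+d≮n) = begin
      cdist n u ((u + d) % n)        ≡⟨ cong (λ y → cdist n u (y % n)) (sym w+n≡u+d) ⟩
      cdist n u ((w + n) % n)        ≡⟨ cong (cdist n u) (trans ([m+n]%n≡m%n w n) (m<n⇒m%n≡m w<n)) ⟩
      cdist n u w                    ≡⟨ cong (λ v → cdist n v w) (sym w+[n∸d]≡u) ⟩
      cdist n (w + (n ∸ d)) w        ≡⟨ cdist-comm n _ w ⟩
      cdist n w (w + (n ∸ d))        ≡⟨ cdist-+ n w (n ∸ d) ⟩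
      (n ∸ d) ⊓ (n ∸ (n ∸ d))        ≡⟨ cong ((n ∸ d) ⊓_) (m∸[m∸n]≡n d≤n) ⟩
      (n ∸ d) ⊓ d                    ≡⟨ ⊓-comm (n ∸ d) d ⟩
      d ⊓ (n ∸ d)                    ∎
      where
      open ≡-Reasoning
      w : ℕ
      w = u + d ∸ n
      w+n≡u+d : w + n ≡ u + d
      w+n≡u+d = m∸n+n≡m (≮⇒≥ u+d≮n)
      w+[n∸d]≡u : w + (n ∸ d) ≡ u
      w+[n∸d]≡u = +-cancelʳ-≡ d _ u (begin
        w + (n ∸ d) + d   ≡⟨ +-assoc w (n ∸ d) d ⟩
        w + (n ∸ d + d)   ≡⟨ cong (w +_) (m∸n+n≡m d≤n) ⟩
        w + n             ≡⟨ w+n≡u+d ⟩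
        u + d             ∎)
      w<n : w < n
      w<n = ≤-<-trans (+-cancelʳ-≤ n w u (≤-trans (≤-reflexive w+n≡u+d) (+-monoʳ-≤ u d≤n))) (m%n<n x n)

⊓∸≡0⇒≡0 : ∀ {n d} → d < n → d ⊓ (n ∸ d) ≡ 0 → d ≡ 0
⊓∸≡0⇒≡0 {d = zero}  _   _  = refl
⊓∸≡0⇒≡0 {n} {suc d} d<n eq =
  contradiction (subst (1 ≤_) eq (⊓-glb (s≤s z≤n) (m<n⇒0<n∸m d<n))) λ ()

∑< : ℕ → (ℕ → ℕ) → ℕ
∑< zero    f = 0
∑< (suc m) f = f 0 + ∑< m (λ i → f (suc i))

syntax ∑< m (λ i → e) = ∑[ i < m ] e

∑-cong : ∀ m {f g : ℕ → ℕ} → (∀ i → i < m → f i ≡ g i) → ∑< m f ≡ ∑< m g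
∑-cong zero    f≡g = refl
∑-cong (suc m) f≡g = cong₂ _+_ (f≡g 0 z<s) (∑-cong m (λ i i<m → f≡g (suc i) (s<s i<m)))

∑-mono-≤ : ∀ m {f g : ℕ → ℕ} → (∀ i → i < m → f i ≤ g i) → ∑< m f ≤ ∑< m g
∑-mono-≤ zero    f≤g = z≤n
∑-mono-≤ (suc m) f≤g = +-mono-≤ (f≤g 0 z<s) (∑-mono-≤ m (λ i i<m → f≤g (suc i) (s<s i<m)))

∑-const : ∀ m c → ∑[ i < m ] c ≡ m * c
∑-const zero    c = refl
∑-const (suc m) c = cong (c +_) (∑-const m c)

∑-≡0 : ∀ m {f : ℕ → ℕ} → (∀ i → i < m → f i ≡ 0) → ∑< m f ≡ 0
∑-≡0 m {f} f≡0 = trans (∑-cong m f≡0) (trans (∑-const m 0) (*-zeroʳ m))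

∑-distrib-+ : ∀ m (f g : ℕ → ℕ) → ∑[ i < m ] (f i + g i) ≡ ∑< m f + ∑< m g
∑-distrib-+ zero    f g = refl
∑-distrib-+ (suc m) f g =
  trans (cong (f 0 + g 0 +_) (∑-distrib-+ m (λ i → f (suc i)) (λ i → g (suc i))))
        (interchange (f 0) (g 0) _ _)

∑-comm : ∀ m l (f : ℕ → ℕ → ℕ) → ∑[ i < m ] ∑[ j < l ] f i j ≡ ∑[ j < l ] ∑[ i < m ] f i j
∑-comm zero    l f = sym (∑-≡0 l (λ _ _ → refl))
∑-comm (suc m) l f = trans (cong (∑< l (f 0) +_) (∑-comm m l (λ i → f (suc i))))
                           (sym (∑-distrib-+ l (f 0) (λ j → ∑[ i < m ] f (suc i) j)))

∑-split : ∀ m l (f : ℕ → ℕ) → ∑< (m + l) f ≡ ∑< m f + ∑[ i < l ] f (m + i)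
∑-split zero    l f = refl
∑-split (suc m) l f = trans (cong (f 0 +_) (∑-split m l (λ i → f (suc i))))
                            (sym (+-assoc (f 0) _ _))

∑-shift : ∀ n (f : ℕ → ℕ) → f n ≡ f 0 → ∑[ i < n ] f (suc i) ≡ ∑< n f
∑-shift n f fn≡f0 = +-cancelˡ-≡ (f 0) _ _ (begin
  ∑< (suc n) f                     ≡⟨ cong (λ m → ∑< m f) (+-comm 1 n) ⟩
  ∑< (n + 1) f                     ≡⟨ ∑-split n 1 f ⟩
  ∑< n f + (f (n + 0) + 0)         ≡⟨ cong (∑< n f +_) (+-identityʳ (f (n + 0))) ⟩
  ∑< n f + f (n + 0)               ≡⟨ cong (λ m → ∑< n f + f m) (+-identityʳ n) ⟩
  ∑< n f + f n                     ≡⟨ cong (∑< n f +_) fn≡f0 ⟩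
  ∑< n f + f 0                     ≡⟨ +-comm (∑< n f) (f 0) ⟩
  f 0 + ∑< n f                     ∎)
  where open ≡-Reasoning

∑-rotate : ∀ n (f : ℕ → ℕ) → (∀ i → f (n + i) ≡ f i) → ∀ t → ∑[ i < n ] f (t + i) ≡ ∑< n f
∑-rotate n f periodic zero    = refl
∑-rotate n f periodic (suc t) =
  trans (∑-rotate n (λ i → f (suc i)) (λ i → trans (cong f (sym (+-suc n i))) (periodic (suc i))) t)
        (∑-shift n f (trans (cong f (sym (+-identityʳ n))) (periodic 0)))

∑-≢0 : ∀ m {f : ℕ → ℕ} → ∑< m f ≢ 0 → ∃[ i ] i < m × f i ≢ 0
∑-≢0 zero    ∑≢0 = contradiction refl ∑≢0
∑-≢0 (suc m) {f} ∑≢0 with f 0 ≟ 0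
... | no f0≢0 = 0 , z<s , f0≢0
... | yes f0≡0 with ∑-≢0 m (λ ∑≡0 → ∑≢0 (cong₂ _+_ f0≡0 ∑≡0))
...   | i , i<m , fi≢0 = suc i , s<s i<m , fi≢0

∑-≤1 : ∀ m {f : ℕ → ℕ} → (∀ i → i < m → f i ≤ 1) →
       (∀ i j → i < m → j < m → f i ≢ 0 → f j ≢ 0 → i ≡ j) → ∑< m f ≤ 1
∑-≤1 zero    f≤1 unique = z≤n
∑-≤1 (suc m) {f} f≤1 unique with f 0 ≟ 0
... | yes f0≡0 = subst (λ x → x + ∑[ i < m ] f (suc i) ≤ 1) (sym f0≡0)
      (∑-≤1 m (λ i i<m → f≤1 (suc i) (s<s i<m))
              (λ i j i<m j<m fi≢0 fj≢0 →
                 suc-injective (unique (suc i) (suc j) (s<s i<m) (s<s j<m) fi≢0 fj≢0)))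
... | no f0≢0 = begin
  f 0 + ∑[ i < m ] f (suc i)  ≡⟨ cong (f 0 +_) (∑-≡0 m rest≡0) ⟩
  f 0 + 0                     ≡⟨ +-identityʳ (f 0) ⟩
  f 0                         ≤⟨ f≤1 0 z<s ⟩
  1                           ∎
  where
  open ≤-Reasoning
  rest≡0 : ∀ i → i < m → f (suc i) ≡ 0
  rest≡0 i i<m with f (suc i) ≟ 0
  ... | yes fi≡0 = fi≡0
  ... | no fi≢0  = contradiction (unique 0 (suc i) z<s (s<s i<m) f0≢0 fi≢0) λ ()

δ : ℕ → ℕ → ℕ
δ zero    zero    = 1
δ zero    (suc _) = 0
δ (suc _) zero    = 0
δ (suc m) (suc n) = δ m n

δ≤1 : ∀ m n → δ m n ≤ 1
δ≤1 zero    zero    = ≤-refl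
δ≤1 zero    (suc n) = z≤n
δ≤1 (suc m) zero    = z≤n
δ≤1 (suc m) (suc n) = δ≤1 m n

δ≢0⇒≡ : ∀ m n → δ m n ≢ 0 → m ≡ n
δ≢0⇒≡ zero    zero    _   = refl
δ≢0⇒≡ zero    (suc n) δ≢0 = contradiction refl δ≢0
δ≢0⇒≡ (suc m) zero    δ≢0 = contradiction refl δ≢0
δ≢0⇒≡ (suc m) (suc n) δ≢0 = cong suc (δ≢0⇒≡ m n δ≢0)

∑-δ : ∀ {m n} → m < n → ∑[ i < n ] δ m i ≡ 1
∑-δ {zero}  {suc n} _         = cong suc (∑-≡0 n (λ _ _ → refl))
∑-δ {suc m} {suc n} (s<s m<n) = ∑-δ m<n

-- Rotate so that a point x₀ of the support sits at 0: the positions b, …, a − b are then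
-- too far from x₀, and t, t + (a − b) are at distance b, so each such pair holds at most one point.
private
  module IndependentAround
         {a b : ℕ} .{{_ : NonZero a}} (h : ℕ → ℕ) (2b≤a : 2 * b ≤ a)
         (h≤1 : ∀ x → x < a → h x ≤ 1)
         (independent : ∀ x y → x < a → y < a → h x ≢ 0 → h y ≢ 0 → cdist a x y < b)
         {x₀ : ℕ} (x₀<a : x₀ < a) (hx₀≢0 : h x₀ ≢ 0) where

    g : ℕ → ℕ
    g t = h ((x₀ + t) % a)

    g≤1 : ∀ t → g t ≤ 1
    g≤1 t = h≤1 _ (m%n<n (x₀ + t) a)

    g0≢0 : g 0 ≢ 0
    g0≢0 = subst (λ x → h x ≢ 0) (sym [x₀+0]%a≡x₀) hx₀≢0
      where
      [x₀+0]%a≡x₀ : (x₀ + 0) % a ≡ x₀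
      [x₀+0]%a≡x₀ = trans (cong (_% a) (+-identityʳ x₀)) (m<n⇒m%n≡m x₀<a)

    far⇒g≡0 : ∀ s d → b ≤ d → d + b ≤ a → g s ≢ 0 → g (s + d) ≡ 0
    far⇒g≡0 s d b≤d d+b≤a gs≢0 with g (s + d) ≟ 0
    ... | yes gsd≡0 = gsd≡0
    ... | no gsd≢0 = contradiction
      (subst (b ≤_) (sym (trans (cong (λ y → cdist a ((x₀ + s) % a) (y % a)) (sym (+-assoc x₀ s d)))
                                (cdist-%-+ (x₀ + s) (≤-trans (m≤m+n d b) d+b≤a))))
             (≤-⊓∸ b≤d d+b≤a))
      (<⇒≱ (independent _ _ (m%n<n (x₀ + s) a) (m%n<n (x₀ + (s + d)) a) gs≢0 gsd≢0))

    c : ℕ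
    c = a ∸ 2 * b

    b+c+b≡a : b + c + b ≡ a
    b+c+b≡a = begin
      b + c + b        ≡⟨ xy∙z≈xz∙y b c b ⟩
      b + b + c        ≡⟨ cong (λ x → b + x + c) (sym (+-identityʳ b)) ⟩
      2 * b + c        ≡⟨ m+[n∸m]≡n 2b≤a ⟩
      a                ∎
      where open ≡-Reasoning

    middle≡0 : ∀ t → t < c → g (b + t) ≡ 0
    middle≡0 t t<c = far⇒g≡0 0 (b + t) (m≤m+n b t)
      (≤-trans (+-monoˡ-≤ b (+-monoʳ-≤ b (<⇒≤ t<c))) (≤-reflexive b+c+b≡a)) g0≢0

    opposite≤1 : ∀ t → g t + g (b + c + t) ≤ 1
    opposite≤1 t with g t ≟ 0
    ... | yes gt≡0 = subst (λ x → x + g (b + c + t) ≤ 1) (sym gt≡0) (g≤1 _)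
    ... | no gt≢0 = subst (λ x → g t + g x ≤ 1) (+-comm t (b + c))
      (subst (λ x → g t + x ≤ 1) (sym (far⇒g≡0 t (b + c) (m≤m+n b c) (≤-reflexive b+c+b≡a) gt≢0))
             (subst (_≤ 1) (sym (+-identityʳ (g t))) (g≤1 t)))

    ∑-independent≤ : ∑< a h ≤ b
    ∑-independent≤ = begin
      ∑< a h                                   ≡⟨ ∑-cong a (λ t t<a → cong h (sym (m<n⇒m%n≡m t<a))) ⟩
      ∑[ t < a ] h (t % a)                     ≡⟨ sym (∑-rotate a (λ t → h (t % a)) a-periodic x₀) ⟩
      ∑< a g                                   ≡⟨ cong (λ m → ∑< m g) (sym b+c+b≡a) ⟩
      ∑< (b + c + b) g                         ≡⟨ ∑-split (b + c) b g ⟩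
      ∑< (b + c) g + ∑[ t < b ] g (b + c + t)  ≡⟨ cong (_+ ∑[ t < b ] g (b + c + t)) outer ⟩
      ∑< b g + ∑[ t < b ] g (b + c + t)        ≡⟨ sym (∑-distrib-+ b g (λ t → g (b + c + t))) ⟩
      ∑[ t < b ] (g t + g (b + c + t))         ≤⟨ ∑-mono-≤ b (λ t _ → opposite≤1 t) ⟩
      ∑[ t < b ] 1                             ≡⟨ ∑-const b 1 ⟩
      b * 1                                    ≡⟨ *-identityʳ b ⟩
      b                                        ∎
      where
      open ≤-Reasoning
      a-periodic : ∀ t → h ((a + t) % a) ≡ h (t % a)
      a-periodic t = cong h (trans (cong (_% a) (+-comm a t)) ([m+n]%n≡m%n t a))
      outer : ∑< (b + c) g ≡ ∑< b g
      outer = trans (∑-split b c g) (trans (cong (∑< b g +_) (∑-≡0 c middle≡0)) (+-identityʳ _))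

∑-independent≤ : ∀ {a b} (h : ℕ → ℕ) → 2 * b ≤ a → (∀ x → x < a → h x ≤ 1) →
                 (∀ x y → x < a → y < a → h x ≢ 0 → h y ≢ 0 → cdist a x y < b) → ∑< a h ≤ b
∑-independent≤ {a} h 2b≤a h≤1 independent with ∑< a h ≟ 0
... | yes ∑≡0 = subst (_≤ _) (sym ∑≡0) z≤n
... | no ∑≢0 with ∑-≢0 a ∑≢0
...   | x₀ , x₀<a , hx₀≢0 =
  IndependentAround.∑-independent≤ {{>-nonZero (≤-<-trans z≤n x₀<a)}}
    h 2b≤a h≤1 independent x₀<a hx₀≢0

module _ {n : ℕ} .{{_ : NonZero n}} (k : ℕ) where

  window : ℕ → ℕ → ℕ
  window s v = ∑[ i < k ] δ v ((s + i) % n)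

  window≢0 : ∀ s v → window s v ≢ 0 → ∃[ i ] i < k × v ≡ (s + i) % n
  window≢0 s v w≢0 with ∑-≢0 k w≢0
  ... | i , i<k , δ≢0 = i , i<k , δ≢0⇒≡ v _ δ≢0

  ∑-window : ∀ {v} → v < n → ∑[ s < n ] window s v ≡ k
  ∑-window {v} v<n = begin
    ∑[ s < n ] ∑[ i < k ] δ v ((s + i) % n)  ≡⟨ ∑-comm n k (λ s i → δ v ((s + i) % n)) ⟩
    ∑[ i < k ] ∑[ s < n ] δ v ((s + i) % n)  ≡⟨ ∑-cong k (λ i _ → rotated i) ⟩
    ∑[ i < k ] ∑[ s < n ] δ v (s % n)        ≡⟨ ∑-cong k (λ _ _ → trans (∑-cong n reduced) (∑-δ v<n)) ⟩
    ∑[ i < k ] 1                             ≡⟨ ∑-const k 1 ⟩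
    k * 1                                    ≡⟨ *-identityʳ k ⟩
    k                                        ∎
    where
    open ≡-Reasoning
    n-periodic : ∀ s → δ v ((n + s) % n) ≡ δ v (s % n)
    n-periodic s = cong (δ v) (trans (cong (_% n) (+-comm n s)) ([m+n]%n≡m%n s n))
    rotated : ∀ i → ∑[ s < n ] δ v ((s + i) % n) ≡ ∑[ s < n ] δ v (s % n)
    rotated i = trans (∑-cong n (λ s _ → cong (λ y → δ v (y % n)) (+-comm s i)))
                      (∑-rotate n (λ s → δ v (s % n)) n-periodic i)
    reduced : ∀ s → s < n → δ v (s % n) ≡ δ v s
    reduced s s<n = cong (δ v) (m<n⇒m%n≡m s<n)

  module _ (k≤n : k ≤ n) where

    private
      cdist-%-offsets : ∀ s i e → e ≤ n → cdist n ((s + i) % n) ((s + (i + e)) % n) ≡ e ⊓ (n ∸ e)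
      cdist-%-offsets s i e e≤n =
        trans (cong (λ y → cdist n ((s + i) % n) (y % n)) (sym (+-assoc s i e))) (cdist-%-+ (s + i) e≤n)

      window-close-≤ : ∀ s {i j} → i ≤ j → j < k → cdist n ((s + i) % n) ((s + j) % n) < k
      window-close-≤ s {i} {j} i≤j j<k with j ∸ i | m+[n∸m]≡n i≤j
      ... | e | refl = ≤-<-trans (≤-reflexive (cdist-%-offsets s i e e≤n))
                                 (≤-<-trans (m⊓n≤m e (n ∸ e)) (≤-<-trans (m≤n+m e i) j<k))
        where
        e≤n : e ≤ n
        e≤n = ≤-trans (m≤n+m e i) (≤-trans (<⇒≤ j<k) k≤n)

      window-injective-≤ : ∀ s {i j} → i ≤ j → j < k → (s + i) % n ≡ (s + j) % n → i ≡ j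
      window-injective-≤ s {i} {j} i≤j j<k eq with j ∸ i | m+[n∸m]≡n i≤j
      ... | e | refl = sym (trans (cong (i +_) e≡0) (+-identityʳ i))
        where
        e<n : e < n
        e<n = ≤-<-trans (m≤n+m e i) (≤-trans j<k k≤n)
        e≡0 : e ≡ 0
        e≡0 = ⊓∸≡0⇒≡0 e<n (begin
          e ⊓ (n ∸ e)                                  ≡⟨ cdist-%-offsets s i e (<⇒≤ e<n) ⟨
          cdist n ((s + i) % n) ((s + (i + e)) % n)     ≡⟨ cong (λ y → cdist n y ((s + (i + e)) % n)) eq ⟩
          cdist n ((s + (i + e)) % n) ((s + (i + e)) % n) ≡⟨ cdist-self n ((s + (i + e)) % n) ⟩
          0                                            ∎)
          where open ≡-Reasoning

    window-close : ∀ s {i j} → i < k → j < k → cdist n ((s + i) % n) ((s + j) % n) < k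
    window-close s {i} {j} i<k j<k with ≤-total i j
    ... | inj₁ i≤j = window-close-≤ s i≤j j<k
    ... | inj₂ j≤i = subst (_< k) (cdist-comm n ((s + j) % n) ((s + i) % n)) (window-close-≤ s j≤i i<k)

    window≤1 : ∀ s v → window s v ≤ 1
    window≤1 s v = ∑-≤1 k (λ i _ → δ≤1 v _) unique
      where
      unique : ∀ i j → i < k → j < k → δ v ((s + i) % n) ≢ 0 → δ v ((s + j) % n) ≢ 0 → i ≡ j
      unique i j i<k j<k δi≢0 δj≢0
        with ≤-total i j | trans (sym (δ≢0⇒≡ v _ δi≢0)) (δ≢0⇒≡ v _ δj≢0)
      ... | inj₁ i≤j | eq = window-injective-≤ s i≤j j<k eq
      ... | inj₂ j≤i | eq = sym (window-injective-≤ s j≤i i<k (sym eq))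

Hom-trans : ∀ {G H I} → Hom G H → Hom H I → Hom G I
Hom-trans (f , f-adj) (g , g-adj) = (λ x → g (f x)) , (λ x y xy → g-adj (f x) (f y) (f-adj x y xy))

toℕ-mod : ∀ {x a} .{{_ : NonZero a}} → x < a → toℕ (x mod a) ≡ x
toℕ-mod {x} {a} x<a = trans (toℕ-fromℕ< (m%n<n x a)) (m<n⇒m%n≡m x<a)

Hom-K-K⇒≤ : ∀ {a b n k} .{{_ : NonZero n}} → k ≤ n → 2 * b ≤ a → Hom (K a b) (K n k) → a * k ≤ n * b
Hom-K-K⇒≤ {zero}                  _   _    _           = z≤n
Hom-K-K⇒≤ {a@(suc _)} {b} {n} {k} k≤n 2b≤a (g , g-adj) = begin
  a * k                                    ≡⟨ ∑-const a k ⟨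
  ∑[ x < a ] k                             ≡⟨ ∑-cong a (λ x _ → ∑-window k (toℕ<n (g (x mod a)))) ⟨
  ∑[ x < a ] ∑[ s < n ] window k s (G x)   ≡⟨ ∑-comm a n (λ x s → window k s (G x)) ⟩
  ∑[ s < n ] ∑[ x < a ] window k s (G x)   ≤⟨ ∑-mono-≤ n (λ s _ → preimage≤b s) ⟩
  ∑[ s < n ] b                             ≡⟨ ∑-const n b ⟩
  n * b                                    ∎
  where
  open ≤-Reasoning
  G : ℕ → ℕ
  G x = toℕ (g (x mod a))
  independent : ∀ s x y → x < a → y < a → window k s (G x) ≢ 0 → window k s (G y) ≢ 0 → cdist a x y < b
  independent s x y x<a y<a wx≢0 wy≢0
    with cdist a x y <? b | window≢0 k s (G x) wx≢0 | window≢0 k s (G y) wy≢0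
  ... | yes close | _ | _ = close
  ... | no far | i , i<k , Gx≡ | j , j<k , Gy≡ = contradiction
    (g-adj (x mod a) (y mod a)
      (subst₂ (λ u w → b ≤ cdist a u w) (sym (toℕ-mod x<a)) (sym (toℕ-mod y<a)) (≮⇒≥ far)))
    (<⇒≱ (subst₂ (λ u w → cdist n u w < k) (sym Gx≡) (sym Gy≡) (window-close k k≤n s i<k j<k)))
  preimage≤b : ∀ s → ∑[ x < a ] window k s (G x) ≤ b
  preimage≤b s = ∑-independent≤ (λ x → window k s (G x)) 2b≤a (λ x _ → window≤1 k k≤n s (G x)) (independent s)

sum-mono-< : ∀ {m} (f g : Fin m → ℕ) → (∀ i → f i < g i) → sum f + m ≤ sum g
sum-mono-< {zero}  f g f<g = z≤n
sum-mono-< {suc m} f g f<g = begin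
  f fzero + sum (λ i → f (fsuc i)) + suc m       ≡⟨ +-suc _ m ⟩
  suc (f fzero + sum (λ i → f (fsuc i)) + m)     ≡⟨ cong suc (+-assoc (f fzero) _ m) ⟩
  suc (f fzero) + (sum (λ i → f (fsuc i)) + m)   ≤⟨ +-mono-≤ (f<g fzero) (sum-mono-< _ _ (f<g ∘ fsuc)) ⟩
  sum g                                          ∎
  where open ≤-Reasoning

interlace-sum-low : ∀ {n k} (P Q : Polygon n k) → InterlaceLR P Q → sum (pt P) + k ≤ sum (pt Q)
interlace-sum-low P Q (P<Q , _) = sum-mono-< (pt P) (pt Q) P<Q

-- Q i < P (i + 1) for i < k − 1, and Q (k − 1) ≤ n < n + P 0.
interlace-sum-high : ∀ {n k} (P Q : Polygon n k) → InterlaceLR P Q → sum (pt Q) + k ≤ sum (pt P) + n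
interlace-sum-high {n} {zero}   P Q _              = m≤m+n 0 n
interlace-sum-high {n} {suc k′} P Q (_ , Q<nextP) = begin
  sum (pt Q) + suc k′                  ≡⟨ cong (_+ suc k′) (sum-init-last (pt Q)) ⟩
  ∑initQ + lastQ + suc k′              ≡⟨ regroup ∑initQ lastQ k′ ⟩
  (∑initQ + k′) + (lastQ + 1)          ≤⟨ +-mono-≤ init<tail (+-mono-≤ lastQ≤n 1≤firstP) ⟩
  ∑tailP + (n + pt P fzero)            ≡⟨ regroup′ ∑tailP n (pt P fzero) ⟩
  sum (pt P) + n                       ∎
  where
  open ≤-Reasoning
  ∑initQ ∑tailP lastQ : ℕ
  ∑initQ = sum (λ i → pt Q (inject₁ i))
  ∑tailP = sum (λ i → pt P (fsuc i))
  lastQ = pt Q (fromℕ k′)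
  lastQ≤n : lastQ ≤ n
  lastQ≤n = proj₂ (inRange Q (fromℕ k′))
  1≤firstP : 1 ≤ pt P fzero
  1≤firstP = proj₁ (inRange P fzero)
  init<tail : ∑initQ + k′ ≤ ∑tailP
  init<tail = sum-mono-< _ _ (λ i → Q<nextP (inject₁ i) (fsuc i) (cong suc (sym (toℕ-inject₁ i))))
  regroup : ∀ s q m → s + q + suc m ≡ (s + m) + (q + 1)
  regroup = solve-∀
  regroup′ : ∀ s n p → s + (n + p) ≡ p + s + n
  regroup′ = solve-∀

module _ {n : ℕ} .{{_ : NonZero n}} where

  interlace⇒k≤cdist : ∀ {k} (P Q : Polygon n k) → InterlaceLR P Q →
                      k ≤ cdist n (sum (pt P) % n) (sum (pt Q) % n)
  interlace⇒k≤cdist {k} P Q P⋈Q = subst (λ y → k ≤ cdist n (σP % n) (y % n)) σP+D≡σQ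
      (subst (k ≤_) (sym (cdist-%-+ σP D≤n)) (≤-⊓∸ k≤D D+k≤n))
    where
    σP σQ : ℕ
    σP = sum (pt P)
    σQ = sum (pt Q)
    low : σP + k ≤ σQ
    low = interlace-sum-low P Q P⋈Q
    D : ℕ
    D = σQ ∸ σP
    σP+D≡σQ : σP + D ≡ σQ
    σP+D≡σQ = m+[n∸m]≡n (m+n≤o⇒m≤o σP low)
    k≤D : k ≤ D
    k≤D = +-cancelˡ-≤ σP k D (subst (σP + k ≤_) (sym σP+D≡σQ) low)
    D+k≤n : D + k ≤ n
    D+k≤n = +-cancelˡ-≤ σP (D + k) n
      (subst (_≤ σP + n) (trans (cong (_+ k) (sym σP+D≡σQ)) (+-assoc σP D k)) (interlace-sum-high P Q P⋈Q))
    D≤n : D ≤ n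
    D≤n = ≤-trans (m≤m+n D k) D+k≤n

  Hom-IG-K : ∀ {k r} → Hom (IG n k r) (K n k)
  Hom-IG-K {k} = (λ P → sum (pt (proj₁ P)) mod n) , adjacent
    where
    toℕ-sum-mod : ∀ (P : Polygon n k) → sum (pt P) % n ≡ toℕ (sum (pt P) mod n)
    toℕ-sum-mod P = sym (toℕ-fromℕ< (m%n<n (sum (pt P)) n))
    adjacent : ∀ P Q → Interlace (proj₁ P) (proj₁ Q) →
               k ≤ cdist n (toℕ (sum (pt (proj₁ P)) mod n)) (toℕ (sum (pt (proj₁ Q)) mod n))
    adjacent (P , _) (Q , _) (inj₁ P⋈Q) =
      subst₂ (λ u w → k ≤ cdist n u w) (toℕ-sum-mod P) (toℕ-sum-mod Q) (interlace⇒k≤cdist P Q P⋈Q)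
    adjacent (P , _) (Q , _) (inj₂ Q⋈P) =
      subst₂ (λ u w → k ≤ cdist n u w) (toℕ-sum-mod P) (toℕ-sum-mod Q)
        (subst (k ≤_) (cdist-comm n (sum (pt Q) % n) (sum (pt P) % n)) (interlace⇒k≤cdist Q P Q⋈P))

[m+n*o]/o≡m/o+n : ∀ m n o .{{_ : NonZero o}} → (m + n * o) / o ≡ m / o + n
[m+n*o]/o≡m/o+n m n o = trans (+-distrib-/-∣ʳ m (n∣m*n n)) (cong (m / o +_) (m*n/n≡m n o))

m+n*o≤p⇒m/o+n≤p/o : ∀ {m p} n o .{{_ : NonZero o}} → m + n * o ≤ p → m / o + n ≤ p / o
m+n*o≤p⇒m/o+n≤p/o {m} {p} n o m+no≤p = subst (_≤ p / o) ([m+n*o]/o≡m/o+n m n o) (/-monoˡ-≤ o m+no≤p)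

module _ {n k r : ℕ} .{{_ : NonZero k}} (rk≤n : r * k ≤ n) (k≤n : k ≤ n) where

  private
    corner : ℕ → ℕ → ℕ
    corner x i = (x + i * n) / k

    offset-gap : ∀ c x {i j} → c * k ≤ n → i < j → x + i * n + c * k ≤ x + j * n
    offset-gap c x {i} {j} ck≤n i<j = begin
      x + i * n + c * k   ≤⟨ +-monoʳ-≤ (x + i * n) ck≤n ⟩
      x + i * n + n       ≡⟨ +-assoc x (i * n) n ⟩
      x + (i * n + n)     ≡⟨ cong (x +_) (+-comm (i * n) n) ⟩
      x + suc i * n       ≤⟨ +-monoʳ-≤ x (*-monoˡ-≤ n i<j) ⟩
      x + j * n           ∎
      where open ≤-Reasoning

    corner-gap : ∀ c x {i j} → c * k ≤ n → i < j → corner x i + c ≤ corner x j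
    corner-gap c x ck≤n i<j = m+n*o≤p⇒m/o+n≤p/o c k (offset-gap c x ck≤n i<j)

    corner-wrap : ∀ c x i {j} → c * k ≤ n → j < k → corner x j + c ≤ corner x i + n
    corner-wrap c x i {j} ck≤n j<k = begin
      corner x j + c        ≤⟨ corner-gap c x ck≤n j<k ⟩
      (x + k * n) / k       ≡⟨ cong (λ m → (x + m) / k) (*-comm k n) ⟩
      (x + n * k) / k       ≡⟨ [m+n*o]/o≡m/o+n x n k ⟩
      x / k + n             ≤⟨ +-monoˡ-≤ n (/-monoˡ-≤ k (m≤m+n x (i * n))) ⟩
      corner x i + n        ∎
      where open ≤-Reasoning

    corner<n : ∀ {x i} → x < n → i < k → corner x i < n
    corner<n {x} {i} x<n i<k = m<n*o⇒m/o<n (begin-strict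
      x + i * n     <⟨ +-monoˡ-< (i * n) x<n ⟩
      n + i * n     ≤⟨ *-monoˡ-≤ n i<k ⟩
      k * n         ≡⟨ *-comm k n ⟩
      n * k         ∎)
      where open ≤-Reasoning

    1+corner≤ : ∀ {x y i j} → x + i * n + k ≤ y + j * n → suc (corner x i) ≤ corner y j
    1+corner≤ {x} {y} {i} {j} le = subst (_≤ corner y j) (+-comm (corner x i) 1)
      (m+n*o≤p⇒m/o+n≤p/o 1 k (subst (λ c → x + i * n + c ≤ y + j * n) (sym (*-identityˡ k)) le))

    shifted : ∀ {a b c} t → a + c ≤ b → a + t + c ≤ b + t
    shifted {a} {b} {c} t a+c≤b = subst (_≤ b + t) (sym (xy∙z≈xz∙y a t c)) (+-monoˡ-≤ t a+c≤b)

  regularPolygon : Fin n → Polygon n k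
  regularPolygon x = record
    { pt      = λ i → suc (corner (toℕ x) (toℕ i))
    ; inRange = λ i → s≤s z≤n , corner<n (toℕ<n x) (toℕ<n i)
    ; sorted  = λ i j i<j → s≤s (subst (_≤ corner (toℕ x) (toℕ j)) (+-comm _ 1)
                                  (corner-gap 1 (toℕ x) (subst (_≤ n) (sym (*-identityˡ k)) k≤n) i<j))
    }

  regularPolygon-stable : ∀ x → Stable r (regularPolygon x)
  regularPolygon-stable x i j i≢j with <-cmp (toℕ i) (toℕ j)
  ... | tri< i<j _ _ = ≤-cdist (s≤s (corner-gap r (toℕ x) rk≤n i<j))
                               (s≤s (corner-wrap r (toℕ x) (toℕ i) rk≤n (toℕ<n j)))
  ... | tri≈ _ i≡j _ = contradiction (toℕ-injective i≡j) i≢j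
  ... | tri> _ _ j<i = subst (r ≤_) (cdist-comm n (pt (regularPolygon x) j) (pt (regularPolygon x) i))
                         (≤-cdist (s≤s (corner-gap r (toℕ x) rk≤n j<i))
                                  (s≤s (corner-wrap r (toℕ x) (toℕ j) rk≤n (toℕ<n i))))

  private
    regularPolygon-interlace : ∀ x y → toℕ x + k ≤ toℕ y → toℕ y + k ≤ toℕ x + n →
                               InterlaceLR (regularPolygon x) (regularPolygon y)
    regularPolygon-interlace x y x+k≤y y+k≤x+n = below , above
      where
      X Y : ℕ
      X = toℕ x
      Y = toℕ y
      below : ∀ i → pt (regularPolygon x) i < pt (regularPolygon y) i
      below i = s≤s (1+corner≤ {X} {Y} {toℕ i} {toℕ i} (shifted {X} (toℕ i * n) x+k≤y))
      above : ∀ i j → toℕ j ≡ suc (toℕ i) → pt (regularPolygon y) i < pt (regularPolygon x) j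
      above i j j≡1+i = s≤s (1+corner≤ {Y} {X} {toℕ i} {toℕ j} (begin
        Y + toℕ i * n + k     ≤⟨ shifted {Y} (toℕ i * n) y+k≤x+n ⟩
        X + n + toℕ i * n     ≡⟨ +-assoc X n (toℕ i * n) ⟩
        X + suc (toℕ i) * n   ≡⟨ cong (λ m → X + m * n) j≡1+i ⟨
        X + toℕ j * n         ∎))
        where open ≤-Reasoning

  Hom-K-IG : Hom (K n k) (IG n k r)
  Hom-K-IG = (λ x → regularPolygon x , regularPolygon-stable x) , adjacent
    where
    adjacent : ∀ x y → k ≤ cdist n (toℕ x) (toℕ y) → Interlace (regularPolygon x) (regularPolygon y)
    adjacent x y k≤d with <-cmp (toℕ x) (toℕ y)
    ... | tri< x<y _ _ with ≤-cdist⁻ (<⇒≤ x<y) (<⇒≤ (toℕ<n y)) k≤d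
    ...   | x+k≤y , y+k≤x+n = inj₁ (regularPolygon-interlace x y x+k≤y y+k≤x+n)
    adjacent x y k≤d | tri≈ _ x≡y _ =
      contradiction (subst (k ≤_) (trans (cong (cdist n (toℕ x)) (sym x≡y)) (cdist-self n (toℕ x))) k≤d)
                    (<⇒≱ (>-nonZero⁻¹ k))
    adjacent x y k≤d | tri> _ _ y<x
      with ≤-cdist⁻ (<⇒≤ y<x) (<⇒≤ (toℕ<n x)) (subst (k ≤_) (cdist-comm n (toℕ x) (toℕ y)) k≤d)
    ...   | y+k≤x , x+k≤y+n = inj₂ (regularPolygon-interlace y x y+k≤x x+k≤y+n)

theorem4 : (n k r : ℕ) → 1 ≤ k → 2 ≤ r → r * k ≤ n →
           CircCliqueNumberIs (IG n k r) n k
theorem4 n k r 1≤k 2≤r rk≤n =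
    Hom-K-IG rk≤n k≤n
  , λ a b _ 2b≤a f → Hom-K-K⇒≤ k≤n 2b≤a (Hom-trans {K a b} {IG n k r} {K n k} f Hom-IG-K)
  where
  k≤n : k ≤ n
  k≤n = ≤-trans (m≤n*m k r {{>-nonZero (≤-trans (s≤s z≤n) 2≤r)}}) rk≤n
  instance
    k≢0 : NonZero k
    k≢0 = >-nonZero 1≤k
    n≢0 : NonZero n
    n≢0 = >-nonZero (≤-trans 1≤k k≤n)
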